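{- Let $G_1\le\mathrm{Sym}(n_1),\dots,G_k\le\mathrm{Sym}(n_k)$ be permutation groups and let $G=G_1\times\cdots\times G_k$ be their external direct product acting on $\Omega=[n_1]\times\cdots\times[n_k]$ by $(x_1,\dots,x_k)^{(g_1,\dots,g_k)}=(g_1(x_1),\dots,g_k(x_k))$. If every $G_i$ (with its natural action on $[n_i]$) has the EKR property, then $G$ (acting on $\Omega$) has the EKR property; and if every $G_i$ has the strict EKR property, then $G$ has the strict EKR property.
   Context: For a group $G$ acting faithfully on a finite set $\Omega$: $\pi,\sigma\in G$ intersect if $\pi\sigma^{ -1}$ fixes some point of $\Omega$; a subset is intersecting if every pair of its elements intersect. $G$ has the EKR property if every intersecting subset of $G$ has size at most the size of the largest point-stabilizer $G_x$, $x\in\Omega$. $G$ has the strict EKR property if it has the EKR property and every intersecting subset of maximum size is a coset of a point-stabilizer, i.e. a set $\{\pi\in G:\pi(x)=y\}$ for some $x,y\in\Omega$. -}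

module Defs where

open import Level using (0ℓ)
open import Data.Nat using (ℕ; zero; suc; _≤_; _⊔_)
open import Data.Fin using (Fin)
open import Data.Fin.Properties using () renaming (_≟_ to _≟F_)
open import Data.Unit using (⊤; tt)
open import Data.Unit.Properties using () renaming (_≟_ to _≟⊤_)
open import Data.Product using (Σ; ∃; ∃-syntax; _×_; _,_)
open import Data.Product.Properties using (≡-dec)
open import Data.Product.Function.NonDependent.Propositional using (_×-↔_)
open import Data.List using (List; []; _∷_; length; filter; map; concatMap; foldr)
open import Data.List.Relation.Unary.All using (All)
open import Data.List.Relation.Unary.Any using (Any)
open import Data.List.Relation.Unary.AllPairs using (AllPairs)
open import Data.Fin.Base using () renaming (zero to fzero; suc to fsuc)
import Data.List as L
open import Function using (_∘_; _⇔_)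
open import Function.Bundles using (Inverse; _↔_)
open import Function.Properties.Inverse using (↔-refl; ↔-sym; ↔-trans)
open import Relation.Nullary using (¬_)
open import Relation.Binary using (DecidableEquality)
open import Relation.Binary.PropositionalEquality using (_≡_)

Perm : Set → Set
Perm Ω = Ω ↔ Ω

_⟨$⟩_ : {Ω : Set} → Perm Ω → Ω → Ω
π ⟨$⟩ x = Inverse.to π x

_≈ₚ_ : {Ω : Set} → Perm Ω → Perm Ω → Set
π ≈ₚ σ = ∀ x → π ⟨$⟩ x ≡ σ ⟨$⟩ x

-- product in Sym(Ω): (π · σ)(x) = π(σ(x))
_·_ : {Ω : Set} → Perm Ω → Perm Ω → Perm Ω
π · σ = ↔-trans σ π

_⁻¹ : {Ω : Set} → Perm Ω → Perm Ω
π ⁻¹ = ↔-sym π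

idP : {Ω : Set} → Perm Ω
idP = ↔-refl

-- A finite set of permutations, given as a list (up to ≈ₚ)

_∈ₚ_ : {Ω : Set} → Perm Ω → List (Perm Ω) → Set
π ∈ₚ G = Any (π ≈ₚ_) G

Distinct : {Ω : Set} → List (Perm Ω) → Set
Distinct = AllPairs (λ π σ → ¬ (π ≈ₚ σ))

record IsPermGroup {Ω : Set} (G : List (Perm Ω)) : Set where
  field
    distinct : Distinct G
    has-id   : idP ∈ₚ G
    mul-closed : ∀ π σ → π ∈ₚ G → σ ∈ₚ G → (π · σ) ∈ₚ G
    inv-closed : ∀ π → π ∈ₚ G → (π ⁻¹) ∈ₚ G

-- EKR notions for a permutation group G ≤ Sym(Ω), where Ω is a finite
-- set with decidable equality, enumerated by the list ΩL.

Intersect : {Ω : Set} → Perm Ω → Perm Ω → Set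
Intersect {Ω} π σ = ∃[ x ] ((π · (σ ⁻¹)) ⟨$⟩ x ≡ x)

IsIntersecting : {Ω : Set} → List (Perm Ω) → List (Perm Ω) → Set
IsIntersecting G F = All (_∈ₚ G) F × Distinct F × AllPairs Intersect F

stabSize : {Ω : Set} → DecidableEquality Ω → List (Perm Ω) → Ω → ℕ
stabSize _≟_ G x = length (filter (λ π → (π ⟨$⟩ x) ≟ x) G)

maxStab : {Ω : Set} → DecidableEquality Ω → List Ω → List (Perm Ω) → ℕ
maxStab _≟_ ΩL G = foldr (λ x m → stabSize _≟_ G x ⊔ m) 0 ΩL

HasEKR : {Ω : Set} → DecidableEquality Ω → List Ω → List (Perm Ω) → Set
HasEKR _≟_ ΩL G = ∀ F → IsIntersecting G F → length F ≤ maxStab _≟_ ΩL G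

IsStabCoset : {Ω : Set} → List (Perm Ω) → List (Perm Ω) → Set
IsStabCoset {Ω} G F =
  ∃[ x ] ∃[ y ] (∀ π → π ∈ₚ G → (π ∈ₚ F ⇔ (π ⟨$⟩ x ≡ y)))

HasStrictEKR : {Ω : Set} → DecidableEquality Ω → List Ω → List (Perm Ω) → Set
HasStrictEKR _≟_ ΩL G =
  HasEKR _≟_ ΩL G ×
  (∀ F → IsIntersecting G F →
     (∀ F′ → IsIntersecting G F′ → length F′ ≤ length F) →
     IsStabCoset G F)

allFin : (n : ℕ) → List (Fin n)
allFin zero = []
allFin (suc n) = fzero ∷ map fsuc (allFin n)

ProdΩ : (k : ℕ) → (Fin k → ℕ) → Set
ProdΩ zero    n = ⊤
ProdΩ (suc k) n = Fin (n fzero) × ProdΩ k (n ∘ fsuc)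

_≟Π_ : {k : ℕ} {n : Fin k → ℕ} → DecidableEquality (ProdΩ k n)
_≟Π_ {zero}  = _≟⊤_
_≟Π_ {suc k} = ≡-dec _≟F_ _≟Π_

enumΠ : (k : ℕ) (n : Fin k → ℕ) → List (ProdΩ k n)
enumΠ zero    n = tt ∷ []
enumΠ (suc k) n =
  concatMap (λ a → map (λ r → (a , r)) (enumΠ k (n ∘ fsuc))) (allFin (n fzero))

prodGroup : (k : ℕ) (n : Fin k → ℕ) → ((i : Fin k) → List (Perm (Fin (n i))))
          → List (Perm (ProdΩ k n))
prodGroup zero    n G = idP ∷ []
prodGroup (suc k) n G =
  concatMap (λ g → map (λ h → g ×-↔ h) (prodGroup k (n ∘ fsuc) (G ∘ fsuc)))
            (G fzero)

module Submission where

-- Induct on k, splitting the product as A ⊗ B with A = G₁. The stabilizer of (x , y) in A ⊗ B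
-- is A_x × B_y, so the largest stabilizer has m₁ m₂ elements. Write an intersecting family F of
-- A ⊗ B as pairs (g , h). For a fixed h₀ the first factors of the pairs with h ≈ h₀ are an
-- intersecting family of A, hence at most m₁ of them, and the distinct second factors form an
-- intersecting family Q of B, hence at most m₂ of them: |F| ≤ m₁ |Q| ≤ m₁ m₂.
-- If F is maximum, |F| ≥ m₁ m₂ forces |Q| ≥ m₂, so Q is a maximum intersecting family of B and,
-- by strict EKR for B, all second factors send some y to some y′; symmetrically all first factors
-- send some x to some x′. So F lies in the coset of (x , y) ↦ (x′ , y′), and maximality makes it
-- the whole coset.

open import Level using (0ℓ)
open import Function using (_∘_; _⇔_; Inverse; Equivalence; mk⇔)
open import Relation.Nullary using (¬_; Dec; yes; no)
open import Relation.Unary using (Pred; Decidable)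
open import Relation.Unary.Properties using (∁?)
open import Relation.Binary using (DecidableEquality)
open import Relation.Binary.PropositionalEquality
  using (_≡_; refl; sym; trans; cong; cong₂; subst; subst₂; module ≡-Reasoning)
open import Data.Empty using (⊥-elim)
open import Data.Unit using (tt)
open import Data.Unit.Properties using () renaming (_≟_ to _≟⊤_)
open import Data.Sum using (_⊎_; inj₁; inj₂)
open import Data.Product using (∃; ∃₂; _×_; _,_; proj₁; proj₂; swap)
open import Data.Product.Properties using (≡-dec; ×-≡,≡→≡; ×-≡,≡←≡)
open import Data.Product.Function.NonDependent.Propositional using (_×-↔_)
open import Data.Nat using (ℕ; zero; suc; _+_; _*_; _≤_; _<_; z≤n; s≤s; >-nonZero)
open import Data.Nat.Properties hiding (_≟_)
open import Data.Fin using (Fin) renaming (zero to fzero; suc to fsuc)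
open import Data.Fin.Properties using (_≟_)
open import Data.List using (List; []; _∷_; length; filter; map; concatMap; _++_)
open import Data.List.Properties
  using (length-map; length-filter; length-++; filter-++; filter-none; filter-accept; filter-reject)
open import Data.List.Membership.Propositional using (_∈_; find)
open import Data.List.Relation.Unary.All as All using (All; []; _∷_)
import Data.List.Relation.Unary.All.Properties as All
open import Data.List.Relation.Unary.Any as Any using (Any; here; there)
import Data.List.Relation.Unary.Any.Properties as Any
open import Data.List.Relation.Unary.AllPairs as AllPairs using (AllPairs; []; _∷_)
import Data.List.Relation.Unary.AllPairs.Properties as AllPairs
open import Data.List.Relation.Binary.Pointwise using (Pointwise; []; _∷_; Pointwise-length; symmetric)
open import Data.List.Relation.Binary.Sublist.Propositional using (_⊆_; []; _∷_; _∷ʳ_; ⊆-refl; ⊆-trans)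
open import Data.List.Relation.Binary.Sublist.Propositional.Properties
  using (All-resp-⊆; filter-⊆; length-mono-≤) renaming (map⁺ to ⊆-map⁺; filter⁺ to ⊆-filter⁺)

open import Defs

module _ {A : Set} {P : Pred A 0ℓ} (P? : Decidable P) where

  length-filter-∁ : ∀ xs → length (filter P? xs) + length (filter (∁? P?) xs) ≡ length xs
  length-filter-∁ [] = refl
  length-filter-∁ (x ∷ xs) with P? x
  ... | yes _ = cong suc (length-filter-∁ xs)
  ... | no _ = trans (+-suc _ _) (cong suc (length-filter-∁ xs))

  All-filter-∁⁻ : ∀ {Q : Pred A 0ℓ} xs → All Q (filter P? xs) → All Q (filter (∁? P?) xs) → All Q xs
  All-filter-∁⁻ [] _ _ = []
  All-filter-∁⁻ (x ∷ xs) qs rs with P? x | qs | rs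
  ... | yes _ | q ∷ qs | rs = q ∷ All-filter-∁⁻ xs qs rs
  ... | no _ | qs | r ∷ rs = r ∷ All-filter-∁⁻ xs qs rs

module _ {A : Set} {R : A → A → Set} where

  All⇒AllPairs : {P : Pred A 0ℓ} → (∀ {x y} → P x → P y → R x y) → ∀ {xs} → All P xs → AllPairs R xs
  All⇒AllPairs f [] = []
  All⇒AllPairs f (p ∷ ps) = All.map (f p) ps ∷ All⇒AllPairs f ps

  AllPairs-restrict : {P : Pred A 0ℓ} {S : A → A → Set} → (∀ {x y} → P x → P y → R x y → S x y) →
                      ∀ {xs} → All P xs → AllPairs R xs → AllPairs S xs
  AllPairs-restrict f [] [] = []
  AllPairs-restrict f (p ∷ ps) (r ∷ rs) = All.zipWith (λ (q , s) → f p q s) (ps , r) ∷ AllPairs-restrict f ps rs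

  AllPairs-resp-⊆ : ∀ {xs ys} → xs ⊆ ys → AllPairs R ys → AllPairs R xs
  AllPairs-resp-⊆ [] [] = []
  AllPairs-resp-⊆ (_ ∷ʳ τ) (_ ∷ rs) = AllPairs-resp-⊆ τ rs
  AllPairs-resp-⊆ (refl ∷ τ) (r ∷ rs) = All-resp-⊆ τ r ∷ AllPairs-resp-⊆ τ rs

module _ {A B : Set} {_∼_ : A → B → Set} where

  Pointwise-All : {P : Pred A 0ℓ} {Q : Pred B 0ℓ} → (∀ {x y} → x ∼ y → P x → Q y) →
                  ∀ {xs ys} → Pointwise _∼_ xs ys → All P xs → All Q ys
  Pointwise-All f [] [] = []
  Pointwise-All f (e ∷ es) (p ∷ ps) = f e p ∷ Pointwise-All f es ps

  Pointwise-AllPairs : {R : A → A → Set} {S : B → B → Set} →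
                       (∀ {x y x′ y′} → x ∼ x′ → y ∼ y′ → R x y → S x′ y′) →
                       ∀ {xs ys} → Pointwise _∼_ xs ys → AllPairs R xs → AllPairs S ys
  Pointwise-AllPairs f [] [] = []
  Pointwise-AllPairs f (e ∷ es) (r ∷ rs) = Pointwise-All (f e) es r ∷ Pointwise-AllPairs f es rs

module _ {A B C : Set} (f : A → B → C) where

  productWith : List A → List B → List C
  productWith xs ys = concatMap (λ x → map (f x) ys) xs

  module _ {P : Pred C 0ℓ} where

    Any-productWith⁺ : ∀ {xs ys} → Any (λ x → Any (λ y → P (f x y)) ys) xs → Any P (productWith xs ys)
    Any-productWith⁺ = Any.concat⁺ ∘ Any.map⁺ ∘ Any.map Any.map⁺

    Any-productWith⁻ : ∀ xs {ys} → Any P (productWith xs ys) → Any (λ x → Any (λ y → P (f x y)) ys) xs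
    Any-productWith⁻ xs = Any.map Any.map⁻ ∘ Any.map⁻ ∘ Any.concat⁻ (map _ xs)

  ∈-productWith⁺ : ∀ {xs ys x y} → x ∈ xs → y ∈ ys → f x y ∈ productWith xs ys
  ∈-productWith⁺ x∈ y∈ = Any-productWith⁺ (Any.map (λ { refl → Any.map (cong (f _)) y∈ }) x∈)

  module _ {P : Pred A 0ℓ} {Q : Pred B 0ℓ} {R : Pred C 0ℓ}
           (P? : Decidable P) (Q? : Decidable Q) (R? : Decidable R)
           (R⇔P×Q : ∀ x y → R (f x y) ⇔ (P x × Q y)) where

    private
      open Equivalence

      length-filter-row : ∀ {x} → P x → ∀ ys → length (filter R? (map (f x) ys)) ≡ length (filter Q? ys)
      length-filter-row px [] = refl
      length-filter-row {x} px (y ∷ ys) with R? (f x y) | Q? y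
      ... | yes _ | yes _ = cong suc (length-filter-row px ys)
      ... | no _ | no _ = length-filter-row px ys
      ... | yes r | no ¬q = ⊥-elim (¬q (proj₂ (to (R⇔P×Q x y) r)))
      ... | no ¬r | yes q = ⊥-elim (¬r (from (R⇔P×Q x y) (px , q)))

      length-filter-row-∅ : ∀ {x} → ¬ P x → ∀ ys → length (filter R? (map (f x) ys)) ≡ 0
      length-filter-row-∅ {x} ¬px ys =
        cong length (filter-none R? (All.map⁺ (All.universal (λ y → ¬px ∘ proj₁ ∘ to (R⇔P×Q x y)) ys)))

    length-filter-productWith : ∀ xs ys →
      length (filter R? (productWith xs ys)) ≡ length (filter P? xs) * length (filter Q? ys)
    length-filter-productWith [] ys = refl
    length-filter-productWith (x ∷ xs) ys = begin
      length (filter R? (map (f x) ys ++ productWith xs ys))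
        ≡⟨ cong length (filter-++ R? (map (f x) ys) (productWith xs ys)) ⟩
      length (filter R? (map (f x) ys) ++ filter R? (productWith xs ys))
        ≡⟨ length-++ (filter R? (map (f x) ys)) ⟩
      length (filter R? (map (f x) ys)) + length (filter R? (productWith xs ys))
        ≡⟨ cong (length (filter R? (map (f x) ys)) +_) (length-filter-productWith xs ys) ⟩
      length (filter R? (map (f x) ys)) + length (filter P? xs) * length (filter Q? ys)
        ≡⟨ row (P? x) ⟩
      length (filter P? (x ∷ xs)) * length (filter Q? ys) ∎
      where
        open ≡-Reasoning
        row : Dec (P x) → length (filter R? (map (f x) ys)) + length (filter P? xs) * length (filter Q? ys)
                        ≡ length (filter P? (x ∷ xs)) * length (filter Q? ys)
        row (yes px) rewrite filter-accept P? {xs = xs} px = cong (_+ _) (length-filter-row px ys)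
        row (no ¬px) rewrite filter-reject P? {xs = xs} ¬px = cong (_+ _) (length-filter-row-∅ ¬px ys)

module _ {A B : Set} (f : A → B) {_~_ : B → B → Set} (_~?_ : ∀ b c → Dec (b ~ c)) where

  fibre : B → List A → List A
  fibre b = filter (λ x → b ~? f x)

  record Transversal (m : ℕ) (xs : List A) : Set where
    field
      reps       : List B
      reps⊆      : reps ⊆ map f xs
      reps-apart : AllPairs (λ b c → ¬ b ~ c) reps
      covers     : All (λ x → Any (_~ f x) reps) xs
      length≤    : length xs ≤ m * length reps

  -- Choose f x as a representative, charge its whole fibre (at most m elements) to it,
  -- and recurse on the elements outside that fibre.
  transversal : (∀ {b} → b ~ b) → ∀ m xs → (∀ b → length (fibre b xs) ≤ m) → Transversal m xs
  transversal ~-refl m xs = go (length xs) xs ≤-refl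
    where
      open Transversal
      go : ∀ n xs → length xs ≤ n → (∀ b → length (fibre b xs) ≤ m) → Transversal m xs
      go _ [] _ _ = record { reps = [] ; reps⊆ = [] ; reps-apart = [] ; covers = [] ; length≤ = z≤n }
      go (suc n) (x ∷ xs) (s≤s |xs|≤n) fibre≤ = record
        { reps       = f x ∷ reps rest
        ; reps⊆      = refl ∷ ⊆-trans (reps⊆ rest) (⊆-map⁺ f (filter-⊆ apart? xs))
        ; reps-apart = All-resp-⊆ (reps⊆ rest) (All.map⁺ (All.all-filter apart? xs)) ∷ reps-apart rest
        ; covers     = here ~-refl ∷ All-filter-∁⁻ near? xs
                         (All.map here (All.all-filter near? xs)) (All.map there (covers rest))
        ; length≤    = begin
            suc (length xs)                                 ≡⟨ cong suc (sym (length-filter-∁ near? xs)) ⟩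
            suc (length (fibre (f x) xs)) + length outside  ≤⟨ +-mono-≤ own-fibre≤ (length≤ rest) ⟩
            m + m * length (reps rest)                      ≡⟨ sym (*-suc m _) ⟩
            m * suc (length (reps rest))                    ∎
        }
        where
          open ≤-Reasoning
          near? : ∀ y → Dec (f x ~ f y)
          near? y = f x ~? f y
          apart? : ∀ y → Dec (¬ f x ~ f y)
          apart? = ∁? near?
          outside : List A
          outside = filter apart? xs
          fibre-mono : ∀ {b ys zs} → ys ⊆ zs → length (fibre b ys) ≤ length (fibre b zs)
          fibre-mono τ = length-mono-≤ (⊆-filter⁺ _ _ (λ { refl p → p }) τ)
          own-fibre≤ : suc (length (fibre (f x) xs)) ≤ m
          own-fibre≤ = subst (_≤ m) (cong length (filter-accept (λ y → f x ~? f y) ~-refl)) (fibre≤ (f x))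
          rest : Transversal m outside
          rest = go n outside (≤-trans (length-filter apart? xs) |xs|≤n)
                   (λ b → ≤-trans (fibre-mono (filter-⊆ apart? xs))
                                  (≤-trans (fibre-mono (x ∷ʳ ⊆-refl)) (fibre≤ b)))

module _ {Ω : Set} where

  ≈ₚ-refl : {π : Perm Ω} → π ≈ₚ π
  ≈ₚ-refl _ = refl

  ≈ₚ-sym : {π σ : Perm Ω} → π ≈ₚ σ → σ ≈ₚ π
  ≈ₚ-sym e x = sym (e x)

  ≈ₚ-trans : {π σ τ : Perm Ω} → π ≈ₚ σ → σ ≈ₚ τ → π ≈ₚ τ
  ≈ₚ-trans e e′ x = trans (e x) (e′ x)

  ≈ₚ-dec : DecidableEquality Ω → (L : List Ω) → (∀ x → x ∈ L) → (π σ : Perm Ω) → Dec (π ≈ₚ σ)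
  ≈ₚ-dec _≟_ L complete π σ with All.all? (λ x → (π ⟨$⟩ x) ≟ (σ ⟨$⟩ x)) L
  ... | yes agree = yes (λ x → All.lookup agree (complete x))
  ... | no disagree = no (λ e → disagree (All.universal e L))

  from-≈ₚ : {π σ : Perm Ω} → π ≈ₚ σ → ∀ x → Inverse.from π x ≡ Inverse.from σ x
  from-≈ₚ {π} {σ} e x = begin
    Inverse.from π x                         ≡⟨ cong (Inverse.from π) (sym (Inverse.strictlyInverseˡ σ x)) ⟩
    Inverse.from π (σ ⟨$⟩ Inverse.from σ x)  ≡⟨ cong (Inverse.from π) (sym (e _)) ⟩
    Inverse.from π (π ⟨$⟩ Inverse.from σ x)  ≡⟨ Inverse.strictlyInverseʳ π _ ⟩
    Inverse.from σ x                         ∎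
    where open ≡-Reasoning

  Intersect-resp-≈ₚ : {π π′ σ σ′ : Perm Ω} → π ≈ₚ π′ → σ ≈ₚ σ′ → Intersect π σ → Intersect π′ σ′
  Intersect-resp-≈ₚ {π} {π′} {σ} {σ′} eπ eσ (x , fixed) =
    x , trans (sym (eπ _)) (trans (cong (π ⟨$⟩_) (sym (from-≈ₚ {σ} {σ′} eσ x))) fixed)

  agree⇒Intersect : {π σ : Perm Ω} {x y : Ω} → π ⟨$⟩ x ≡ y → σ ⟨$⟩ x ≡ y → Intersect π σ
  agree⇒Intersect {π} {σ} {x} {y} πx σx =
    y , trans (cong (π ⟨$⟩_) (trans (cong (Inverse.from σ) (sym σx)) (Inverse.strictlyInverseʳ σ x))) πx

  ∈⇒∈ₚ : {π : Perm Ω} {G : List (Perm Ω)} → π ∈ G → π ∈ₚ G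
  ∈⇒∈ₚ {π} = Any.map (λ { refl → ≈ₚ-refl {π} })

  ∈ₚ-self : (G : List (Perm Ω)) → All (_∈ₚ G) G
  ∈ₚ-self G = All.tabulate ∈⇒∈ₚ

module _ {Ω : Set} (_≟_ : DecidableEquality Ω) where

  fixes? : (x : Ω) (π : Perm Ω) → Dec (π ⟨$⟩ x ≡ x)
  fixes? x π = (π ⟨$⟩ x) ≟ x

  stabilizer : List (Perm Ω) → Ω → List (Perm Ω)
  stabilizer G x = filter (fixes? x) G

  stabilizer-intersecting : {G : List (Perm Ω)} → Distinct G → ∀ x → IsIntersecting G (stabilizer G x)
  stabilizer-intersecting {G} distinct x =
      All.filter⁺ (fixes? x) (∈ₚ-self G)
    , AllPairs.filter⁺ (fixes? x) distinct
    , All⇒AllPairs (λ {π} {σ} → agree⇒Intersect {π = π} {σ = σ}) (All.all-filter (fixes? x) G)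

  stabSize≤maxStab : ∀ {L} G {x} → x ∈ L → stabSize _≟_ G x ≤ maxStab _≟_ L G
  stabSize≤maxStab G {x} (here refl) = m≤m⊔n _ _
  stabSize≤maxStab G {x} (there x∈L) = ≤-trans (stabSize≤maxStab G x∈L) (m≤n⊔m _ _)

  maxStab-attained : ∀ L G → maxStab _≟_ L G ≡ 0 ⊎ ∃ λ x → x ∈ L × stabSize _≟_ G x ≡ maxStab _≟_ L G
  maxStab-attained [] G = inj₁ refl
  maxStab-attained (y ∷ L) G with ⊔-sel (stabSize _≟_ G y) (maxStab _≟_ L G) | maxStab-attained L G
  ... | inj₁ at-y | _ = inj₂ (y , here refl , sym at-y)
  ... | inj₂ at-L | inj₁ L≡0 = inj₁ (trans at-L L≡0)
  ... | inj₂ at-L | inj₂ (x , x∈L , at-x) = inj₂ (x , there x∈L , trans at-x (sym at-L))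

IntersectingBound : {Ω : Set} → List (Perm Ω) → ℕ → Set
IntersectingBound G m = ∀ F → IsIntersecting G F → length F ≤ m

module _ {Ω : Set} {G : List (Perm Ω)} where

  IsIntersecting-∷ : ∀ {F π x y} → IsIntersecting G F → All (λ σ → σ ⟨$⟩ x ≡ y) F →
                     π ∈ₚ G → π ⟨$⟩ x ≡ y → ¬ π ∈ₚ F → IsIntersecting G (π ∷ F)
  IsIntersecting-∷ {F} {π} (F⊆G , distinct , intersecting) agree π∈G πx π∉F =
      π∈G ∷ F⊆G
    , All.¬Any⇒All¬ F π∉F ∷ distinct
    , All.map (λ {σ} → agree⇒Intersect {π = π} {σ = σ} πx) agree ∷ intersecting

  -- Maximality forces every permutation of G with π x = y into F: otherwise F could be extended.
  maximal⇒IsStabCoset : (∀ π σ → Dec (π ≈ₚ σ)) → ∀ {F x y} → IsIntersecting G F →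
                        IntersectingBound G (length F) → All (λ π → π ⟨$⟩ x ≡ y) F → IsStabCoset G F
  maximal⇒IsStabCoset _≈?_ {F} {x} {y} F-int maximal agree = x , y , λ π π∈G → mk⇔ (on-F π) (into-F π π∈G)
    where
      on-F : ∀ π → π ∈ₚ F → π ⟨$⟩ x ≡ y
      on-F π = All.lookupWith (λ σx π≈σ → trans (π≈σ x) σx) agree
      into-F : ∀ π → π ∈ₚ G → π ⟨$⟩ x ≡ y → π ∈ₚ F
      into-F π π∈G πx with Any.any? (π ≈?_) F
      ... | yes π∈F = π∈F
      ... | no π∉F = ⊥-elim (<-irrefl refl (maximal (π ∷ F) (IsIntersecting-∷ F-int agree π∈G πx π∉F)))

-- The induction carries only these consequences of being a group: products are never shown
-- to be groups. Together with EKR they make maxStab positive, so that Ω has a point; without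
-- one all permutations of Ω coincide and a product family could repeat elements.
record IsEKRFamily {Ω : Set} (_≟_ : DecidableEquality Ω) (L : List Ω) (G : List (Perm Ω)) : Set where
  field
    distinct : Distinct G
    has-id   : idP ∈ₚ G
    ekr      : HasEKR _≟_ L G

  maxStab-positive : 0 < maxStab _≟_ L G
  maxStab-positive = ekr (idP ∷ []) ((has-id ∷ []) , ([] ∷ []) , ([] ∷ []))

  maxStab-argmax : ∃ λ x → stabSize _≟_ G x ≡ maxStab _≟_ L G
  maxStab-argmax with maxStab-attained _≟_ L G
  ... | inj₁ m≡0 = ⊥-elim (<-irrefl (sym m≡0) maxStab-positive)
  ... | inj₂ (x , _ , attained) = x , attained

module _ {X Y : Set} where

  _⊗_ : List (Perm X) → List (Perm Y) → List (Perm (X × Y))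
  _⊗_ = productWith _×-↔_

  _≈⊗_ : Perm (X × Y) → Perm X × Perm Y → Set
  π ≈⊗ (g , h) = π ≈ₚ (g ×-↔ h)

  ×-↔-cong : ∀ {g g′ : Perm X} {h h′ : Perm Y} → g ≈ₚ g′ → h ≈ₚ h′ → (g ×-↔ h) ≈ₚ (g′ ×-↔ h′)
  ×-↔-cong eg eh (x , y) = cong₂ _,_ (eg x) (eh y)

  ×-↔-injectiveˡ : Y → ∀ {g g′ : Perm X} {h h′ : Perm Y} → (g ×-↔ h) ≈ₚ (g′ ×-↔ h′) → g ≈ₚ g′
  ×-↔-injectiveˡ y e x = cong proj₁ (e (x , y))

  ×-↔-injectiveʳ : X → ∀ {g g′ : Perm X} {h h′ : Perm Y} → (g ×-↔ h) ≈ₚ (g′ ×-↔ h′) → h ≈ₚ h′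
  ×-↔-injectiveʳ x e y = cong proj₂ (e (x , y))

  Intersect-×-↔ : ∀ {g g′ : Perm X} {h h′ : Perm Y} →
                  Intersect (g ×-↔ h) (g′ ×-↔ h′) → Intersect g g′ × Intersect h h′
  Intersect-×-↔ ((x , y) , fixed) = (x , cong proj₁ fixed) , (y , cong proj₂ fixed)

  idP-∈ₚ-⊗ : ∀ {A B} → idP ∈ₚ A → idP ∈ₚ B → idP ∈ₚ (A ⊗ B)
  idP-∈ₚ-⊗ {A} {B} id∈A id∈B =
    Any-productWith⁺ _×-↔_ (Any.map (λ {g} e → Any.map (λ {h} → ×-↔-cong {idP} {g} {idP} {h} e) id∈B) id∈A)

  ⊗-distinct : X → Y → ∀ {A B} → Distinct A → Distinct B → Distinct (A ⊗ B)
  ⊗-distinct x y {A} {B} distinctA distinctB =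
    AllPairs.concat⁺ (All.map⁺ (All.universal row-distinct A))
                     (AllPairs.map⁺ (AllPairs.map (λ {g} {g′} → rows-apart {g} {g′}) distinctA))
    where
      row-distinct : ∀ g → Distinct (map (g ×-↔_) B)
      row-distinct g =
        AllPairs.map⁺ (AllPairs.map (λ {h} {h′} h≉h′ → h≉h′ ∘ ×-↔-injectiveʳ x {g} {g} {h} {h′}) distinctB)
      rows-apart : ∀ {g g′} → ¬ g ≈ₚ g′ → All (λ π → All (λ σ → ¬ π ≈ₚ σ) (map (g′ ×-↔_) B)) (map (g ×-↔_) B)
      rows-apart {g} {g′} g≉g′ = All.map⁺ (All.universal
        (λ h → All.map⁺ (All.universal (λ h′ → g≉g′ ∘ ×-↔-injectiveˡ y {g} {g′} {h} {h′}) B)) B)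

  IsIntersectingPairs : List (Perm X) → List (Perm Y) → List (Perm X × Perm Y) → Set
  IsIntersectingPairs A B L =
      All (λ (g , h) → g ∈ₚ A × h ∈ₚ B) L
    × AllPairs (λ (g , h) (g′ , h′) → ¬ (g ≈ₚ g′ × h ≈ₚ h′)) L
    × AllPairs (λ (g , h) (g′ , h′) → Intersect g g′ × Intersect h h′) L

  ∈ₚ-⊗⁻ : ∀ {A B π} → π ∈ₚ (A ⊗ B) → ∃ λ p → (proj₁ p ∈ₚ A × proj₂ p ∈ₚ B) × π ≈⊗ p
  ∈ₚ-⊗⁻ {A} π∈A⊗B with find (Any-productWith⁻ _×-↔_ A π∈A⊗B)
  ... | g , g∈A , π∈g⊗B with find π∈g⊗B
  ... | h , h∈B , π≈g×h = (g , h) , (∈⇒∈ₚ g∈A , ∈⇒∈ₚ h∈B) , π≈g×h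

  All-∈ₚ-⊗⁻ : ∀ A B {F} → All (_∈ₚ (A ⊗ B)) F →
            ∃ λ L → Pointwise _≈⊗_ F L × All (λ (g , h) → g ∈ₚ A × h ∈ₚ B) L
  All-∈ₚ-⊗⁻ A B [] = [] , [] , []
  All-∈ₚ-⊗⁻ A B {π ∷ _} (π∈ ∷ π∈s) with ∈ₚ-⊗⁻ {A} {B} {π} π∈ | All-∈ₚ-⊗⁻ A B π∈s
  ... | p , p∈ , π≈p | L , F≈L , L∈ = p ∷ L , π≈p ∷ F≈L , p∈ ∷ L∈

  factorise : ∀ A B {F} → IsIntersecting (A ⊗ B) F → ∃ λ L → Pointwise _≈⊗_ F L × IsIntersectingPairs A B L
  factorise A B (F⊆A⊗B , distinct , intersecting) with All-∈ₚ-⊗⁻ A B F⊆A⊗B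
  ... | L , F≈L , L∈ = L , F≈L , L∈
    , Pointwise-AllPairs {R = λ π σ → ¬ π ≈ₚ σ}
        (λ {π} {σ} {p} {q} → distinct-factors {π} {σ} {p} {q}) F≈L distinct
    , Pointwise-AllPairs {R = Intersect}
        (λ {π} {σ} {p} {q} → intersecting-factors {π} {σ} {p} {q}) F≈L intersecting
    where
      distinct-factors : ∀ {π σ p q} → π ≈⊗ p → σ ≈⊗ q → ¬ π ≈ₚ σ → ¬ (proj₁ p ≈ₚ proj₁ q × proj₂ p ≈ₚ proj₂ q)
      distinct-factors {π} {σ} {g , h} {g′ , h′} π≈ σ≈ π≉σ (g≈ , h≈) =
        π≉σ (≈ₚ-trans {π = π} {g ×-↔ h} {σ} π≈
              (≈ₚ-trans {π = g ×-↔ h} {g′ ×-↔ h′} {σ} (×-↔-cong {g} {g′} {h} {h′} g≈ h≈)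
                (≈ₚ-sym {π = σ} {g′ ×-↔ h′} σ≈)))
      intersecting-factors : ∀ {π σ p q} → π ≈⊗ p → σ ≈⊗ q → Intersect π σ →
                             Intersect (proj₁ p) (proj₁ q) × Intersect (proj₂ p) (proj₂ q)
      intersecting-factors {π} {σ} {g , h} {g′ , h′} π≈ σ≈ =
        Intersect-×-↔ {g} {g′} {h} {h′} ∘ Intersect-resp-≈ₚ {π = π} {g ×-↔ h} {σ} {g′ ×-↔ h′} π≈ σ≈

module _ {X Y : Set} (_≈?_ : (h h′ : Perm Y) → Dec (h ≈ₚ h′)) where

  fibre-intersecting : ∀ {A B L} → IsIntersectingPairs A B L → ∀ h →
                       IsIntersecting A (map proj₁ (fibre proj₂ _≈?_ h L))
  fibre-intersecting {A} {B} {L} (L∈ , distinct , intersecting) h =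
      All.map⁺ (All.filter⁺ near? (All.map proj₁ L∈))
    , AllPairs.map⁺ (AllPairs-restrict (λ {p} {q} → first-distinct {p} {q})
                      (All.all-filter near? L) (AllPairs.filter⁺ near? distinct))
    , AllPairs.map⁺ (AllPairs.map proj₁ (AllPairs.filter⁺ near? intersecting))
    where
      near? : ∀ (p : Perm X × Perm Y) → Dec (h ≈ₚ proj₂ p)
      near? p = h ≈? proj₂ p
      first-distinct : ∀ {p q} → h ≈ₚ proj₂ p → h ≈ₚ proj₂ q → ¬ (proj₁ p ≈ₚ proj₁ q × proj₂ p ≈ₚ proj₂ q) →
                       ¬ proj₁ p ≈ₚ proj₁ q
      first-distinct {p} {q} h≈p h≈q p≉q p₁≈q₁ =
        p≉q (p₁≈q₁ , ≈ₚ-trans {π = proj₂ p} {h} {proj₂ q} (≈ₚ-sym {π = h} {proj₂ p} h≈p) h≈q)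

  record SecondFactors (B : List (Perm Y)) (m : ℕ) (L : List (Perm X × Perm Y)) : Set where
    field
      factors₂     : List (Perm Y)
      intersecting : IsIntersecting B factors₂
      covers       : All (λ (_ , h) → Any (_≈ₚ h) factors₂) L
      length≤      : length L ≤ m * length factors₂

  secondFactors : ∀ {A B m L} → IntersectingBound A m → IsIntersectingPairs A B L → SecondFactors B m L
  secondFactors {A} {B} {m} {L} boundA L-int@(L∈ , _ , intersecting) = record
    { factors₂     = reps
    ; intersecting = All-resp-⊆ reps⊆ (All.map⁺ (All.map proj₂ L∈))
                   , reps-apart
                   , AllPairs-resp-⊆ reps⊆ (AllPairs.map⁺ (AllPairs.map proj₂ intersecting))
    ; covers       = covers
    ; length≤      = length≤
    }
    where
      fibre≤ : ∀ h → length (fibre proj₂ _≈?_ h L) ≤ m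
      fibre≤ h = subst (_≤ m) (length-map proj₁ (fibre proj₂ _≈?_ h L)) (boundA _ (fibre-intersecting L-int h))
      open Transversal (transversal proj₂ _≈?_ (λ {h} → ≈ₚ-refl {π = h}) m L fibre≤)

IsIntersectingPairs-swap : ∀ {X Y} {A : List (Perm X)} {B : List (Perm Y)} {L} →
                           IsIntersectingPairs A B L → IsIntersectingPairs B A (map swap L)
IsIntersectingPairs-swap (L∈ , distinct , intersecting) =
    All.map⁺ (All.map swap L∈)
  , AllPairs.map⁺ (AllPairs.map (_∘ swap) distinct)
  , AllPairs.map⁺ (AllPairs.map swap intersecting)

module _ {X Y : Set} (_≟_ : DecidableEquality Y) (YL : List Y) (_≈?_ : (h h′ : Perm Y) → Dec (h ≈ₚ h′)) where

  -- The second factors of L form an intersecting family of at least maxStab B elements,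
  -- hence a maximum one, hence a stabilizer coset.
  secondFactors-inCoset : ∀ {A : List (Perm X)} {B m L} → IntersectingBound A m → 0 < m → HasStrictEKR _≟_ YL B →
                      IsIntersectingPairs A B L → m * maxStab _≟_ YL B ≤ length L →
                      ∃₂ λ x y → All (λ (_ , h) → h ⟨$⟩ x ≡ y) L
  secondFactors-inCoset {A} {B} {m} {L} boundA 0<m (ekrB , strictB) L-int m*m₂≤|L| =
    x , y , All.map (λ {p} → on-coset {p}) covers
    where
      open SecondFactors (secondFactors _≈?_ boundA L-int)
      maximal : IntersectingBound B (length factors₂)
      maximal F′ F′-int = ≤-trans (ekrB F′ F′-int) (*-cancelˡ-≤ m {{>-nonZero 0<m}} (≤-trans m*m₂≤|L| length≤))
      coset : IsStabCoset B factors₂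
      coset = strictB factors₂ intersecting maximal
      x = proj₁ coset
      y = proj₁ (proj₂ coset)
      on-coset : ∀ {p : Perm X × Perm Y} → Any (_≈ₚ proj₂ p) factors₂ → proj₂ p ⟨$⟩ x ≡ y
      on-coset {p} h∈ with find h∈
      ... | q , q∈ , q≈h = trans (sym (q≈h x))
        (Equivalence.to (proj₂ (proj₂ coset) q (All.lookup (proj₁ intersecting) q∈)) (∈⇒∈ₚ q∈))

module Product {X Y : Set}
  (_≟X_ : DecidableEquality X) (XL : List X) (XL-complete : ∀ x → x ∈ XL)
  (_≟Y_ : DecidableEquality Y) (YL : List Y) (YL-complete : ∀ y → y ∈ YL) where

  _≟XY_ : DecidableEquality (X × Y)
  _≟XY_ = ≡-dec _≟X_ _≟Y_

  XYL : List (X × Y)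
  XYL = productWith _,_ XL YL

  XYL-complete : ∀ z → z ∈ XYL
  XYL-complete (x , y) = ∈-productWith⁺ _,_ (XL-complete x) (YL-complete y)

  stabSize-⊗ : ∀ A B x y → stabSize _≟XY_ (A ⊗ B) (x , y) ≡ stabSize _≟X_ A x * stabSize _≟Y_ B y
  stabSize-⊗ A B x y = length-filter-productWith _×-↔_ (fixes? _≟X_ x) (fixes? _≟Y_ y) (fixes? _≟XY_ (x , y))
                         (λ _ _ → mk⇔ ×-≡,≡←≡ ×-≡,≡→≡) A B

  maxStab-⊗ : ∀ A B → maxStab _≟X_ XL A * maxStab _≟Y_ YL B ≤ maxStab _≟XY_ XYL (A ⊗ B)
  maxStab-⊗ A B with maxStab-attained _≟X_ XL A | maxStab-attained _≟Y_ YL B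
  ... | inj₁ m₁≡0 | _ rewrite m₁≡0 = z≤n
  ... | inj₂ _ | inj₁ m₂≡0 rewrite m₂≡0 | *-zeroʳ (maxStab _≟X_ XL A) = z≤n
  ... | inj₂ (x , x∈ , at-x) | inj₂ (y , y∈ , at-y) = begin
    maxStab _≟X_ XL A * maxStab _≟Y_ YL B        ≡⟨ sym (cong₂ _*_ at-x at-y) ⟩
    stabSize _≟X_ A x * stabSize _≟Y_ B y        ≡⟨ sym (stabSize-⊗ A B x y) ⟩
    stabSize _≟XY_ (A ⊗ B) (x , y)               ≤⟨ stabSize≤maxStab _≟XY_ (A ⊗ B) (∈-productWith⁺ _,_ x∈ y∈) ⟩
    maxStab _≟XY_ XYL (A ⊗ B)                    ∎
    where open ≤-Reasoning

  ⊗-HasEKR : ∀ {A B} → HasEKR _≟X_ XL A → HasEKR _≟Y_ YL B → HasEKR _≟XY_ XYL (A ⊗ B)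
  ⊗-HasEKR {A} {B} ekrA ekrB F F-int with factorise A B F-int
  ... | L , F≈L , L-int = begin
    length F                                 ≡⟨ Pointwise-length F≈L ⟩
    length L                                 ≤⟨ length≤ ⟩
    maxStab _≟X_ XL A * length factors₂      ≤⟨ *-monoʳ-≤ (maxStab _≟X_ XL A) (ekrB factors₂ intersecting) ⟩
    maxStab _≟X_ XL A * maxStab _≟Y_ YL B    ≤⟨ maxStab-⊗ A B ⟩
    maxStab _≟XY_ XYL (A ⊗ B)                ∎
    where
      open ≤-Reasoning
      open SecondFactors (secondFactors (≈ₚ-dec _≟Y_ YL YL-complete) ekrA L-int)

  ⊗-IsEKRFamily : ∀ {A B} → IsEKRFamily _≟X_ XL A → IsEKRFamily _≟Y_ YL B → IsEKRFamily _≟XY_ XYL (A ⊗ B)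
  ⊗-IsEKRFamily famA famB = record
    { distinct = ⊗-distinct (proj₁ (A.maxStab-argmax)) (proj₁ (B.maxStab-argmax)) A.distinct B.distinct
    ; has-id   = idP-∈ₚ-⊗ A.has-id B.has-id
    ; ekr      = ⊗-HasEKR A.ekr B.ekr
    }
    where
      module A = IsEKRFamily famA
      module B = IsEKRFamily famB

  ⊗-HasStrictEKR : ∀ {A B} → IsEKRFamily _≟X_ XL A → IsEKRFamily _≟Y_ YL B →
                   HasStrictEKR _≟X_ XL A → HasStrictEKR _≟Y_ YL B → HasStrictEKR _≟XY_ XYL (A ⊗ B)
  ⊗-HasStrictEKR {A} {B} famA famB strictA strictB = ⊗-HasEKR A.ekr B.ekr , coset
    where
      module A = IsEKRFamily famA
      module B = IsEKRFamily famB
      m₁ = maxStab _≟X_ XL A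
      m₂ = maxStab _≟Y_ YL B
      x₀ = proj₁ A.maxStab-argmax
      y₀ = proj₁ B.maxStab-argmax

      -- A maximum family is at least as large as the stabilizer of (x₀ , y₀), which has m₁ m₂ elements.
      m₁m₂≤ : ∀ F → IntersectingBound (A ⊗ B) (length F) → m₁ * m₂ ≤ length F
      m₁m₂≤ F maximal = begin
        m₁ * m₂                                      ≡⟨ sym (cong₂ _*_ (proj₂ A.maxStab-argmax) (proj₂ B.maxStab-argmax)) ⟩
        stabSize _≟X_ A x₀ * stabSize _≟Y_ B y₀      ≡⟨ sym (stabSize-⊗ A B x₀ y₀) ⟩
        length (stabilizer _≟XY_ (A ⊗ B) (x₀ , y₀))  ≤⟨ maximal _ (stabilizer-intersecting _≟XY_ distinct (x₀ , y₀)) ⟩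
        length F                                     ∎
        where
          open ≤-Reasoning
          distinct = IsEKRFamily.distinct (⊗-IsEKRFamily famA famB)

      inCoset : ∀ {L} → IsIntersectingPairs A B L → m₁ * m₂ ≤ length L →
                    ∃₂ λ x y → All (λ (g , h) → (g ×-↔ h) ⟨$⟩ x ≡ y) L
      inCoset {L} L-int m₁m₂≤|L| with first | second
        where
          second : ∃₂ λ y y′ → All (λ (_ , h) → h ⟨$⟩ y ≡ y′) L
          second = secondFactors-inCoset _≟Y_ YL (≈ₚ-dec _≟Y_ YL YL-complete) A.ekr A.maxStab-positive strictB
                     L-int m₁m₂≤|L|
          first : ∃₂ λ x x′ → All (λ (_ , g) → g ⟨$⟩ x ≡ x′) (map swap L)
          first = secondFactors-inCoset _≟X_ XL (≈ₚ-dec _≟X_ XL XL-complete) B.ekr B.maxStab-positive strictA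
                    (IsIntersectingPairs-swap L-int)
                    (subst₂ _≤_ (*-comm m₁ m₂) (sym (length-map swap L)) m₁m₂≤|L|)
      ... | x , x′ , fix₁ | y , y′ , fix₂ =
        (x , y) , (x′ , y′) , All.zipWith (λ (gx , hy) → cong₂ _,_ gx hy) (All.map⁻ fix₁ , fix₂)

      coset : ∀ F → IsIntersecting (A ⊗ B) F → IntersectingBound (A ⊗ B) (length F) → IsStabCoset (A ⊗ B) F
      coset F F-int maximal with factorise A B F-int
      ... | L , F≈L , L-int with inCoset L-int (subst (m₁ * m₂ ≤_) (Pointwise-length F≈L) (m₁m₂≤ F maximal))
      ... | z , z′ , fix = maximal⇒IsStabCoset (≈ₚ-dec _≟XY_ XYL XYL-complete) F-int maximal
        (Pointwise-All (λ {p} {π} π≈p fixed → trans (π≈p z) fixed) (symmetric (λ {π} {p} e → e) F≈L) fix)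

allFin-complete : ∀ n (i : Fin n) → i ∈ allFin n
allFin-complete (suc n) fzero = here refl
allFin-complete (suc n) (fsuc i) = there (Any.map⁺ (Any.map (cong fsuc) (allFin-complete n i)))

enumΠ-complete : ∀ k n (z : ProdΩ k n) → z ∈ enumΠ k n
enumΠ-complete zero n tt = here refl
enumΠ-complete (suc k) n (i , z) = ∈-productWith⁺ _,_ (allFin-complete (n fzero) i) (enumΠ-complete k (n ∘ fsuc) z)

trivial-IsEKRFamily : IsEKRFamily _≟⊤_ (tt ∷ []) (idP ∷ [])
trivial-IsEKRFamily = record
  { distinct = [] ∷ []
  ; has-id   = here (λ _ → refl)
  ; ekr      = λ { [] _ → z≤n
                 ; (_ ∷ []) _ → s≤s z≤n
                 ; (_ ∷ _ ∷ _) (_ , ((π≉σ ∷ _) ∷ _) , _) → ⊥-elim (π≉σ (λ _ → refl))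
                 }
  }

trivial-HasStrictEKR : HasStrictEKR _≟⊤_ (tt ∷ []) (idP ∷ [])
trivial-HasStrictEKR = IsEKRFamily.ekr trivial-IsEKRFamily , coset
  where
    coset : ∀ F → IsIntersecting (idP ∷ []) F → IntersectingBound (idP ∷ []) (length F) → IsStabCoset (idP ∷ []) F
    coset [] _ maximal with maximal (idP ∷ []) ((here (λ _ → refl) ∷ []) , ([] ∷ []) , ([] ∷ []))
    ... | ()
    coset (_ ∷ _) _ _ = tt , tt , λ _ _ → mk⇔ (λ _ → refl) (λ _ → here (λ _ → refl))

module ProductStep (k : ℕ) (n : Fin (suc k) → ℕ) =
  Product _≟_  (allFin (n fzero))    (allFin-complete (n fzero))
          _≟Π_ (enumΠ k (n ∘ fsuc)) (enumΠ-complete k (n ∘ fsuc))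

prodGroup-IsEKRFamily : ∀ k n G → (∀ i → IsEKRFamily _≟_ (allFin (n i)) (G i)) →
                        IsEKRFamily _≟Π_ (enumΠ k n) (prodGroup k n G)
prodGroup-IsEKRFamily zero n G _ = trivial-IsEKRFamily
prodGroup-IsEKRFamily (suc k) n G fam =
  ⊗-IsEKRFamily (fam fzero) (prodGroup-IsEKRFamily k (n ∘ fsuc) (G ∘ fsuc) (fam ∘ fsuc))
  where open ProductStep k n

prodGroup-HasStrictEKR : ∀ k n G → (∀ i → IsEKRFamily _≟_ (allFin (n i)) (G i)) →
                         (∀ i → HasStrictEKR _≟_ (allFin (n i)) (G i)) →
                         HasStrictEKR _≟Π_ (enumΠ k n) (prodGroup k n G)
prodGroup-HasStrictEKR zero n G _ _ = trivial-HasStrictEKR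
prodGroup-HasStrictEKR (suc k) n G fam strict =
  ⊗-HasStrictEKR (fam fzero) (prodGroup-IsEKRFamily k (n ∘ fsuc) (G ∘ fsuc) (fam ∘ fsuc))
    (strict fzero) (prodGroup-HasStrictEKR k (n ∘ fsuc) (G ∘ fsuc) (fam ∘ fsuc) (strict ∘ fsuc))
  where open ProductStep k n

theorem5p14 : (k : ℕ) (n : Fin k → ℕ) (G : (i : Fin k) → List (Perm (Fin (n i))))
  → ((i : Fin k) → IsPermGroup (G i))
  → (((i : Fin k) → HasEKR _≟_ (allFin (n i)) (G i))
       → HasEKR _≟Π_ (enumΠ k n) (prodGroup k n G))
    × (((i : Fin k) → HasStrictEKR _≟_ (allFin (n i)) (G i))
       → HasStrictEKR _≟Π_ (enumΠ k n) (prodGroup k n G))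
theorem5p14 k n G groups =
    (λ ekr → IsEKRFamily.ekr (prodGroup-IsEKRFamily k n G (family ekr)))
  , (λ strict → prodGroup-HasStrictEKR k n G (family (proj₁ ∘ strict)) strict)
  where
    family : (∀ i → HasEKR _≟_ (allFin (n i)) (G i)) → ∀ i → IsEKRFamily _≟_ (allFin (n i)) (G i)
    family ekr i = record
      { distinct = IsPermGroup.distinct (groups i)
      ; has-id   = IsPermGroup.has-id (groups i)
      ; ekr      = ekr i
      }
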